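{- Let $\pi\in S_n$. If $|\pi(1)-\pi(n)|=1$, $\pi(1)\ne n$, and $\pi(n)\ne1$, then $\gamma(G_\pi)=2$ and $\{\pi(1),\pi(n)\}$ is a minimum dominating set of $G_\pi$.
   Context: For a permutation $\pi$ of $[n]=\{1,\dots,n\}$ (one-line notation $[\pi(1),\dots,\pi(n)]$), the permutation graph $G_\pi$ has vertex set $[n]$ and an edge between $i<j$ iff $\pi^{ -1}(i)>\pi^{ -1}(j)$. $\gamma(G)$ is the minimum size of a set $D$ of vertices such that every vertex is in $D$ or adjacent to a vertex of $D$ (a minimum dominating set). -}

module Defs where

open import Data.Nat using (ℕ; suc) renaming (_≤_ to _≤ℕ_)
open import Data.Fin using (Fin; toℕ; _<_; _>_)
open import Data.Fin.Permutation using (Permutation′; _⟨$⟩ˡ_)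
open import Data.Fin.Subset using (Subset; _∈_; ∣_∣)
open import Data.Product using (_×_; Σ; ∃)
open import Data.Sum using (_⊎_)
open import Relation.Binary.PropositionalEquality using (_≡_)

-- Vertices of G_π are Fin n (vertex k : Fin n stands for the value toℕ k + 1).
-- π : Permutation′ n maps positions to values: π ⟨$⟩ʳ p = π(p+1) - 1 (0-based).
-- π ⟨$⟩ˡ v is the position of value v, i.e. π⁻¹.

Inversion : ∀ {n} → Permutation′ n → Fin n → Fin n → Set
Inversion π i j = (i < j) × ((π ⟨$⟩ˡ i) > (π ⟨$⟩ˡ j))

Adj : ∀ {n} → Permutation′ n → Fin n → Fin n → Set
Adj π u v = Inversion π u v ⊎ Inversion π v u

Dominating : ∀ {n} → Permutation′ n → Subset n → Set
Dominating {n} π D = (v : Fin n) → v ∈ D ⊎ ∃ λ u → u ∈ D × Adj π u v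

MinDominating : ∀ {n} → Permutation′ n → Subset n → Set
MinDominating {n} π D = Dominating π D × ((D′ : Subset n) → Dominating π D′ → ∣ D ∣ ≤ℕ ∣ D′ ∣)

DominationNumber : ∀ {n} → Permutation′ n → ℕ → Set
DominationNumber π k = Σ (Subset _) λ D → MinDominating π D × ∣ D ∣ ≡ k

module Submission where

-- Write a = π(1) and b = π(n).  In G_π the vertex a, sitting at the first
-- position, is adjacent exactly to the values smaller than a; symmetrically
-- b, sitting at the last position, is adjacent exactly to the values larger
-- than b.  Since |a - b| = 1, every value other than a and b lies below a
-- or above b, so {a, b} dominates G_π.  Conversely no vertex u is adjacent
-- to all others: a misses the top value n (as a ≠ n), b misses 1 (as
-- b ≠ 1), a vertex above a misses a, a vertex below b misses b, and by
-- consecutiveness there is nothing else.  A graph without such a universal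
-- vertex needs at least two vertices to dominate it.

open import Defs
open import Data.Nat using (ℕ; suc)
open import Data.Fin using (Fin; toℕ; fromℕ; zero)
open import Data.Fin.Permutation using (Permutation′; _⟨$⟩ʳ_)
open import Data.Fin.Subset using (Subset; ⁅_⁆; _∪_)
open import Data.Integer using (+_; ∣_∣; _-_)
open import Data.Product using (_×_)
open import Relation.Binary.PropositionalEquality using (_≡_; _≢_)

import Data.Nat as ℕ
import Data.Nat.Properties as ℕ
import Data.Fin as F
import Data.Fin.Properties as F
import Data.Integer.Properties as ℤ
open import Data.Fin.Permutation using (_⟨$⟩ˡ_; inverseˡ; inverseʳ)
open import Data.Fin.Subset using (inside; outside; _∈_) renaming (∣_∣ to #_; _-_ to _∖_)
open import Data.Fin.Subset.Properties
  using (∣⁅x⁆∣≡1; x∈⁅x⁆; x∈⁅y⁆⇒x≡y; x≢y⇒x∉⁅y⁆; x∈p∪q⁺; x∈p∧x∉q⇒x∈p─q;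
         p⊆q⇒∣p∣≤∣q∣; x∈p⇒∣p-x∣<∣p∣)
open import Data.Vec using ([]; _∷_)
open import Data.Product using (_,_; ∃)
open import Data.Sum using (_⊎_; inj₁; inj₂; swap)
open import Data.Empty using (⊥; ⊥-elim)
open import Relation.Nullary using (¬_; contradiction)
open import Relation.Binary.Definitions using (tri<; tri≈; tri>)
open import Relation.Binary.PropositionalEquality
  using (refl; sym; trans; cong; cong₂; subst; module ≡-Reasoning)
open import Data.Integer using (_⊖_)
open import Function using (_∘_)

Consecutive : ℕ → ℕ → Set
Consecutive x y = x ≡ suc y ⊎ y ≡ suc x

consecutive-sym : ∀ {x y} → Consecutive x y → Consecutive y x
consecutive-sym = swap

consecutive⇒≢ : ∀ {x y} → Consecutive x y → x ≢ y
consecutive⇒≢ (inj₁ x≡1+y) refl = ℕ.1+n≢n (sym x≡1+y)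
consecutive⇒≢ (inj₂ y≡1+x) refl = ℕ.1+n≢n (sym y≡1+x)

-- For x ≤ y the integer distance |x - y| is y ∸ x, so distance one means y = 1 + x.
ordered-distance-one : ∀ {x y} → x ℕ.≤ y → ∣ + x - + y ∣ ≡ 1 → y ≡ suc x
ordered-distance-one {x} {y} x≤y dist = begin
  y                  ≡⟨ ℕ.m∸n+n≡m x≤y ⟨
  (y ℕ.∸ x) ℕ.+ x    ≡⟨ cong (ℕ._+ x) (ℤ.∣⊖∣-≤ x≤y) ⟨
  ∣ x ⊖ y ∣ ℕ.+ x    ≡⟨ cong (λ i → ∣ i ∣ ℕ.+ x) (ℤ.m-n≡m⊖n x y) ⟨
  ∣ + x - + y ∣ ℕ.+ x ≡⟨ cong (ℕ._+ x) dist ⟩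
  suc x              ∎
  where open ≡-Reasoning

∣x-y∣≡1⇒consecutive : ∀ x y → ∣ + x - + y ∣ ≡ 1 → Consecutive x y
∣x-y∣≡1⇒consecutive x y dist with ℕ.≤-total x y
... | inj₁ x≤y = inj₂ (ordered-distance-one x≤y dist)
... | inj₂ y≤x = inj₁ (ordered-distance-one y≤x (trans (ℤ.∣i-j∣≡∣j-i∣ (+ y) (+ x)) dist))

nothing-between : ∀ {x y v} → Consecutive x y → x ℕ.< v → v ℕ.< y → ⊥
nothing-between (inj₁ refl) x<v v<y = ℕ.<-asym (ℕ.<-trans x<v v<y) (ℕ.n<1+n _)
nothing-between (inj₂ refl) x<v v<y = ℕ.<⇒≱ x<v (ℕ.s≤s⁻¹ v<y)

data Region {n} (a b v : Fin n) : Set where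
  below : v F.< a → Region a b v
  is-a  : v ≡ a → Region a b v
  is-b  : v ≡ b → Region a b v
  above : b F.< v → Region a b v

region : ∀ {n} {a b : Fin n} → Consecutive (toℕ a) (toℕ b) → (v : Fin n) → Region a b v
region {a = a} {b} c v with F.<-cmp v a
... | tri< v<a _ _ = below v<a
... | tri≈ _ v≡a _ = is-a v≡a
... | tri> _ _ a<v with F.<-cmp b v
...   | tri< b<v _ _ = above b<v
...   | tri≈ _ b≡v _ = is-b (sym b≡v)
...   | tri> _ _ v<b = ⊥-elim (nothing-between c a<v v<b)

∣p∪q∣≤∣p∣+∣q∣ : ∀ {n} (p q : Subset n) → # (p ∪ q) ℕ.≤ # p ℕ.+ # q
∣p∪q∣≤∣p∣+∣q∣ [] [] = ℕ.z≤n
∣p∪q∣≤∣p∣+∣q∣ (outside ∷ p) (outside ∷ q) = ∣p∪q∣≤∣p∣+∣q∣ p q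
∣p∪q∣≤∣p∣+∣q∣ (inside ∷ p) (outside ∷ q) = ℕ.s≤s (∣p∪q∣≤∣p∣+∣q∣ p q)
∣p∪q∣≤∣p∣+∣q∣ (outside ∷ p) (inside ∷ q) =
  subst (suc (# (p ∪ q)) ℕ.≤_) (sym (ℕ.+-suc (# p) (# q))) (ℕ.s≤s (∣p∪q∣≤∣p∣+∣q∣ p q))
∣p∪q∣≤∣p∣+∣q∣ (inside ∷ p) (inside ∷ q) =
  ℕ.s≤s (ℕ.≤-trans (∣p∪q∣≤∣p∣+∣q∣ p q) (ℕ.+-monoʳ-≤ (# p) (ℕ.n≤1+n (# q))))

-- A subset with two distinct members has at least two elements: removing
-- one of them leaves the other, so the rest still has size at least one.
two-members⇒2≤∣p∣ : ∀ {n} {p : Subset n} {x y : Fin n} → x ∈ p → y ∈ p → x ≢ y → 2 ℕ.≤ # p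
two-members⇒2≤∣p∣ {p = p} {x} {y} x∈p y∈p x≢y = ℕ.≤-trans (ℕ.s≤s 1≤∣p∖x∣) (x∈p⇒∣p-x∣<∣p∣ x∈p)
  where
  ⁅y⁆⊆p∖x : ∀ {z} → z ∈ ⁅ y ⁆ → z ∈ p ∖ x
  ⁅y⁆⊆p∖x z∈⁅y⁆ rewrite x∈⁅y⁆⇒x≡y y z∈⁅y⁆ = x∈p∧x∉q⇒x∈p─q y∈p (x≢y⇒x∉⁅y⁆ (λ y≡x → x≢y (sym y≡x)))
  1≤∣p∖x∣ : 1 ℕ.≤ # (p ∖ x)
  1≤∣p∖x∣ = subst (ℕ._≤ # (p ∖ x)) (∣⁅x⁆∣≡1 y) (p⊆q⇒∣p∣≤∣q∣ ⁅y⁆⊆p∖x)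

∣⁅x⁆∪⁅y⁆∣≡2 : ∀ {n} {x y : Fin n} → x ≢ y → # (⁅ x ⁆ ∪ ⁅ y ⁆) ≡ 2
∣⁅x⁆∪⁅y⁆∣≡2 {x = x} {y} x≢y = ℕ.≤-antisym at-most-two at-least-two
  where
  at-most-two : # (⁅ x ⁆ ∪ ⁅ y ⁆) ℕ.≤ 2
  at-most-two = subst (# (⁅ x ⁆ ∪ ⁅ y ⁆) ℕ.≤_)
                  (cong₂ ℕ._+_ (∣⁅x⁆∣≡1 x) (∣⁅x⁆∣≡1 y)) (∣p∪q∣≤∣p∣+∣q∣ ⁅ x ⁆ ⁅ y ⁆)
  at-least-two : 2 ℕ.≤ # (⁅ x ⁆ ∪ ⁅ y ⁆)
  at-least-two = two-members⇒2≤∣p∣ (x∈p∪q⁺ (inj₁ (x∈⁅x⁆ x))) (x∈p∪q⁺ (inj₂ (x∈⁅x⁆ y))) x≢y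

NoUniversalVertex : ∀ {n} → Permutation′ n → Set
NoUniversalVertex {n} π = (u : Fin n) → ∃ λ w → w ≢ u × ¬ Adj π u w

-- If no vertex is universal, a dominating set of a nonempty graph has two
-- elements: it contains some u (dominating vertex zero), and a non-neighbour
-- w ≠ u of u must be dominated by a further element x ≠ u.
noUniversalVertex⇒2≤∣D∣ : ∀ {m} (π : Permutation′ (suc m)) → NoUniversalVertex π →
                          (D : Subset (suc m)) → Dominating π D → 2 ℕ.≤ # D
noUniversalVertex⇒2≤∣D∣ π noUniv D dom = second-member (first-member (dom zero))
  where
  first-member : zero ∈ D ⊎ ∃ (λ u → u ∈ D × Adj π u zero) → ∃ λ u → u ∈ D
  first-member (inj₁ zero∈D)       = zero , zero∈D
  first-member (inj₂ (u , u∈D , _)) = u , u∈D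

  second-member : (∃ λ u → u ∈ D) → 2 ℕ.≤ # D
  second-member (u , u∈D) with noUniv u
  ... | w , w≢u , ¬u~w with dom w
  ...   | inj₁ w∈D             = two-members⇒2≤∣p∣ u∈D w∈D (λ u≡w → w≢u (sym u≡w))
  ...   | inj₂ (x , x∈D , x~w) = two-members⇒2≤∣p∣ u∈D x∈D (λ { refl → ¬u~w x~w })

adj-sym : ∀ {n} (π : Permutation′ n) {u v : Fin n} → Adj π u v → Adj π v u
adj-sym _ = swap

at-position : ∀ {n} (π : Permutation′ n) {v p : Fin n} → π ⟨$⟩ˡ v ≡ p → v ≡ π ⟨$⟩ʳ p
at-position π π⁻¹v≡p = trans (sym (inverseʳ π)) (cong (π ⟨$⟩ʳ_) π⁻¹v≡p)

module EndVertices {m : ℕ} (π : Permutation′ (suc m)) where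

  first last : Fin (suc m)
  first = π ⟨$⟩ʳ zero
  last  = π ⟨$⟩ʳ fromℕ m

  -- Nothing precedes the first position, so first is adjacent exactly to
  -- the smaller values.
  first-adj⇒smaller : ∀ {w} → Adj π first w → w F.< first
  first-adj⇒smaller {w} (inj₁ (_ , π⁻¹w<0)) =
    contradiction (subst (π ⟨$⟩ˡ w F.<_) (inverseˡ π) π⁻¹w<0) ℕ.n≮0
  first-adj⇒smaller (inj₂ (w<first , _)) = w<first

  smaller⇒first-adj : ∀ {w} → w F.< first → Adj π first w
  smaller⇒first-adj {w} w<first =
    inj₂ (w<first , subst (F._< π ⟨$⟩ˡ w) (sym (inverseˡ π)) 0<π⁻¹w)
    where
    0<π⁻¹w : zero {m} F.< π ⟨$⟩ˡ w
    0<π⁻¹w = F.≤∧≢⇒< ℕ.z≤n (λ 0≡π⁻¹w → F.<⇒≢ w<first (at-position π (sym 0≡π⁻¹w)))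

  -- Nothing follows the last position, so last is adjacent exactly to the
  -- larger values.
  last-adj⇒larger : ∀ {w} → Adj π last w → last F.< w
  last-adj⇒larger (inj₁ (last<w , _)) = last<w
  last-adj⇒larger {w} (inj₂ (_ , top<π⁻¹w)) =
    contradiction (F.≤fromℕ (π ⟨$⟩ˡ w)) (ℕ.<⇒≱ (subst (F._< π ⟨$⟩ˡ w) (inverseˡ π) top<π⁻¹w))

  larger⇒last-adj : ∀ {w} → last F.< w → Adj π last w
  larger⇒last-adj {w} last<w =
    inj₁ (last<w , subst (π ⟨$⟩ˡ w F.<_) (sym (inverseˡ π)) π⁻¹w<top)
    where
    π⁻¹w<top : π ⟨$⟩ˡ w F.< fromℕ m
    π⁻¹w<top = F.≤∧≢⇒< (F.≤fromℕ _) (λ π⁻¹w≡top → F.<⇒≢ last<w (sym (at-position π π⁻¹w≡top)))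

  ends : Subset (suc m)
  ends = ⁅ first ⁆ ∪ ⁅ last ⁆

  first∈ends : first ∈ ends
  first∈ends = x∈p∪q⁺ (inj₁ (x∈⁅x⁆ first))

  last∈ends : last ∈ ends
  last∈ends = x∈p∪q⁺ (inj₂ (x∈⁅x⁆ last))

  ends-dominate : Consecutive (toℕ first) (toℕ last) → Dominating π ends
  ends-dominate c v with region c v
  ... | below v<first = inj₂ (first , first∈ends , smaller⇒first-adj v<first)
  ... | is-a refl     = inj₁ first∈ends
  ... | is-b refl     = inj₁ last∈ends
  ... | above last<v  = inj₂ (last , last∈ends , larger⇒last-adj last<v)

  ends-prevent-universal : Consecutive (toℕ first) (toℕ last) → first ≢ fromℕ m → last ≢ zero →
                           NoUniversalVertex π
  ends-prevent-universal c first≢top last≢0 u with region (consecutive-sym c) u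
  ... | below u<last  = last , F.<⇒≢ u<last ∘ sym ,
                        λ u~last → ℕ.<-asym u<last (last-adj⇒larger (adj-sym π u~last))
  ... | is-a refl     = zero , last≢0 ∘ sym , λ last~0 → ℕ.n≮0 (last-adj⇒larger last~0)
  ... | is-b refl     = fromℕ m , first≢top ∘ sym ,
                        λ first~top → ℕ.<⇒≱ (first-adj⇒smaller first~top) (F.≤fromℕ first)
  ... | above first<u = first , F.<⇒≢ first<u ,
                        λ u~first → ℕ.<-asym first<u (first-adj⇒smaller (adj-sym π u~first))

proposition3 : (m : ℕ) (π : Permutation′ (suc m))
    → ∣ + toℕ (π ⟨$⟩ʳ zero) - + toℕ (π ⟨$⟩ʳ fromℕ m) ∣ ≡ 1
    → π ⟨$⟩ʳ zero ≢ fromℕ m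
    → π ⟨$⟩ʳ fromℕ m ≢ zero
    → DominationNumber π 2 × MinDominating π (⁅ π ⟨$⟩ʳ zero ⁆ ∪ ⁅ π ⟨$⟩ʳ fromℕ m ⁆)
proposition3 m π dist first≢top last≢0 = (ends , minimum , size) , minimum
  where
  open EndVertices π

  consecutive : Consecutive (toℕ first) (toℕ last)
  consecutive = ∣x-y∣≡1⇒consecutive (toℕ first) (toℕ last) dist

  size : # ends ≡ 2
  size = ∣⁅x⁆∪⁅y⁆∣≡2 (consecutive⇒≢ consecutive ∘ cong toℕ)

  lower-bound : (D : Subset (suc m)) → Dominating π D → # ends ℕ.≤ # D
  lower-bound D dom = subst (ℕ._≤ # D) (sym size)
    (noUniversalVertex⇒2≤∣D∣ π (ends-prevent-universal consecutive first≢top last≢0) D dom)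

  minimum : MinDominating π ends
  minimum = ends-dominate consecutive , lower-bound
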